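{- The set-function $\mathrm{Card}$ is not $(\oplus,\otimes,\Downarrow,\mathcal{P})$-definable.
   Context: $\mathbb{N}=\{0,1,2,\ldots\}$, $2^{\mathbb{N}}$ is its power set. A set-function is a map $(2^{\mathbb{N}})^k\to2^{\mathbb{N}}$ for some $k\ge0$. For a collection $\mathcal{O}$ of set-functions, $\mathcal{O}$-circuits are terms built from variables ranging over $2^{\mathbb{N}}$, the constants $\emptyset$, $\mathbb{N}$, $\{n\}$ ($n\in\mathbb{N}$), the operations $\cup$, $\cap$, complement relative to $\mathbb{N}$, and the functions in $\mathcal{O}$; a set-function is $\mathcal{O}$-definable if some $\mathcal{O}$-circuit evaluates to it. $(\oplus,\otimes,\Downarrow,\mathcal{P})$-definable means $(\{\oplus,\otimes,\Downarrow\}\cup\mathcal{P})$-definable, where $s\oplus t=\{m+n\mid m\in s,n\in t\}$, $s\otimes t=\{mn\mid m\in s,n\in t\}$, $\Downarrow(x)=\{m\in\mathbb{N}\mid\exists n\in x,\ m\le n\}$, and $\mathcal{P}$ is the collection of all set-functions (all arities) whose values all lie in $\{\emptyset,\{0\}\}$. $\mathrm{Card}(x)=\{|x|\}$ if $x$ is finite and $\mathbb{N}$ otherwise. -}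

module Defs where

open import Data.Nat using (ℕ; _+_; _*_; _≤_)
open import Data.Fin using (Fin; zero)
open import Data.List using (List; length)
open import Data.List.Membership.Propositional using (_∈_)
open import Data.List.Relation.Unary.Unique.Propositional using (Unique)
open import Data.Product using (Σ; ∃; _×_)
open import Data.Sum using (_⊎_)
open import Data.Empty using (⊥)
open import Relation.Nullary using (¬_)
open import Relation.Binary.PropositionalEquality using (_≡_)
open import Function.Bundles using (_⇔_)

-- Subsets of ℕ, represented as predicates; equality of subsets is
-- extensional (pointwise ⇔).
Pred : Set₁
Pred = ℕ → Set

_≐_ : Pred → Pred → Set
s ≐ t = ∀ n → s n ⇔ t n

SetFun : ℕ → Set₁
SetFun k = (Fin k → Pred) → Pred

-- Set-functions are functions on sets, so they respect extensional equality.
Extensional : {k : ℕ} → SetFun k → Set₁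
Extensional {k} f = ∀ (ρ σ : Fin k → Pred) → (∀ i → ρ i ≐ σ i) → f ρ ≐ f σ

∅ : Pred
∅ _ = ⊥

singleton : ℕ → Pred
singleton m n = n ≡ m

record PFun (k : ℕ) : Set₁ where
  field
    fun    : SetFun k
    ext    : Extensional fun
    values : ∀ ρ → (fun ρ ≐ ∅) ⊎ (fun ρ ≐ singleton 0)

_∪_ _∩_ : Pred → Pred → Pred
(s ∪ t) n = s n ⊎ t n
(s ∩ t) n = s n × t n

∁ : Pred → Pred
∁ s n = ¬ s n

_⊕_ _⊗_ : Pred → Pred → Pred
(s ⊕ t) k = Σ ℕ λ m → Σ ℕ λ n → s m × t n × (m + n ≡ k)
(s ⊗ t) k = Σ ℕ λ m → Σ ℕ λ n → s m × t n × (m * n ≡ k)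

⇓ : Pred → Pred
⇓ x m = Σ ℕ λ n → x n × (m ≤ n)

data Circuit (k : ℕ) : Set₁ where
  var    : Fin k → Circuit k
  cEmpty : Circuit k
  cFull  : Circuit k
  cSing  : ℕ → Circuit k
  cUnion cInter : Circuit k → Circuit k → Circuit k
  cCompl : Circuit k → Circuit k
  cPlus cTimes : Circuit k → Circuit k → Circuit k
  cDown  : Circuit k → Circuit k
  cP     : (j : ℕ) → PFun j → (Fin j → Circuit k) → Circuit k

eval : {k : ℕ} → Circuit k → SetFun k
eval (var i) ρ = ρ i
eval cEmpty ρ = ∅
eval cFull ρ = λ _ → Data.Unit.⊤
  where import Data.Unit
eval (cSing m) ρ = singleton m
eval (cUnion c d) ρ = eval c ρ ∪ eval d ρ
eval (cInter c d) ρ = eval c ρ ∩ eval d ρ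
eval (cCompl c) ρ = ∁ (eval c ρ)
eval (cPlus c d) ρ = eval c ρ ⊕ eval d ρ
eval (cTimes c d) ρ = eval c ρ ⊗ eval d ρ
eval (cDown c) ρ = ⇓ (eval c ρ)
eval (cP j p cs) ρ = PFun.fun p (λ i → eval (cs i) ρ)

Definable : {k : ℕ} → SetFun k → Set₁
Definable {k} f = Σ (Circuit k) λ c → ∀ ρ → eval c ρ ≐ f ρ

Finite : Pred → Set
Finite x = Σ (List ℕ) λ l → ∀ n → x n ⇔ n ∈ l

-- Card(x) = {|x|} if x finite, ℕ otherwise.
Card : Pred → Pred
Card x n = (Σ (List ℕ) λ l → Unique l × (∀ m → x m ⇔ m ∈ l) × (length l ≡ n))
           ⊎ ¬ Finite x

CardFun : SetFun 1
CardFun ρ = Card (ρ zero)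

module Submission where

-- Fix a circuit c and a threshold H.  We attach to c a finite list of
-- threshold-indexed sets, its candidates, whose number does not depend on H,
-- and show: whenever every input of c agrees with ∅ on [0, H], the output of c
-- agrees on [0, H] with one of the candidates (evaluated at H).  This goes by
-- induction on c; ∪, ∩, ∁ and ⊕ only look below their argument, ⊗ does too
-- except at 0, ⇓ either covers [0, H] or only sees its argument below H, and a
-- 𝒫-gate yields ∅ or {0}.  The case splits at ⊗ and ⇓ are classical, so the
-- lemma is proved in the double-negation monad, which suffices for a negative
-- goal.
--
-- If c computed Card, take L = the number of candidates and feed c the L + 1
-- sets {L+1, …, L+n} for n ≤ L: all look empty on [0, L] and have distinct
-- cardinalities n ≤ L.  By pigeonhole two of them match the same candidate,
-- hence c's outputs on them agree at n, contradicting Card.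

open import Defs
open import Relation.Nullary using (¬_)

open import Level using (Level)
open import Function using (_∘_; const)
open import Function.Bundles using (_⇔_; mk⇔; Equivalence)
open import Function.Construct.Identity using (⇔-id)
open import Function.Construct.Symmetry using (⇔-sym)
open import Function.Related.TypeIsomorphisms using (¬-cong-⇔)
open import Data.Sum.Function.Propositional using (_⊎-⇔_)
open import Data.Product.Function.NonDependent.Propositional using (_×-⇔_)
open import Relation.Nullary.Negation using (contradiction; ¬¬-map; negated-stable)
open import Relation.Nullary.Decidable using (yes; no; ¬¬-excluded-middle)
open import Relation.Binary.PropositionalEquality using (_≡_; refl; sym; trans; subst)

open import Data.Nat using (ℕ; zero; suc; _+_; _*_; _≤_; _<_)
open import Data.Nat.Properties
  using (≤-trans; <⇒≤; ≰⇒>; _≤?_; m≤m+n; m≤n+m; +-cancelˡ-≡; *-comm; <-irrefl; n<1+n)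
open import Data.Nat.Divisibility using (∣⇒≤; divides)
open import Data.Fin using (Fin; toℕ)
import Data.Fin as Fin
open import Data.Fin.Properties using (pigeonhole; toℕ≤pred[n])
open import Data.Unit using (⊤; tt)
open import Data.Empty using (⊥; ⊥-elim)
open import Data.Product using (∃; _×_; _,_)
open import Data.Sum using (inj₁; inj₂)
open import Data.List using (List; []; _∷_; [_]; _++_; map; length; lookup; upTo; cartesianProductWith)
open import Data.List.Properties using (length-map; length-upTo)
open import Data.List.Relation.Unary.Any using (Any; here; there; index)
import Data.List.Relation.Unary.Any as Any
open import Data.List.Relation.Unary.Any.Properties
  using (++⁺ˡ; ++⁺ʳ; map⁺; cartesianProductWith⁺; lookup-index)
open import Data.List.Membership.Propositional using (_∈_)
open import Data.List.Membership.Propositional.Properties using (∈-map⁻)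
open import Data.List.Membership.Propositional.Properties.WithK using (unique∧set⇒bag)
open import Data.List.Relation.Unary.Unique.Propositional using (Unique)
import Data.List.Relation.Unary.Unique.Propositional.Properties as Unique
open import Data.List.Relation.Binary.BagAndSetEquality using (∼bag⇒↭)
open import Data.List.Relation.Binary.Permutation.Propositional.Properties using (↭-length)

open Equivalence using (to; from)

private
  variable
    a b : Level
    A : Set a
    B : Set b
    H k n n′ : ℕ
    S T D E : Pred
    l : List ℕ

_>>=_ : ¬ ¬ A → (A → ¬ ¬ B) → ¬ ¬ B
m >>= f = negated-stable (¬¬-map f m)

return : A → ¬ ¬ A
return = contradiction

¬¬-Π-Fin : ∀ N {P : Fin N → Set a} → (∀ i → ¬ ¬ P i) → ¬ ¬ (∀ i → P i)
¬¬-Π-Fin zero    h = return λ ()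
¬¬-Π-Fin (suc N) h = do
  p₀ ← h Fin.zero
  ps ← ¬¬-Π-Fin N (h ∘ Fin.suc)
  return λ { Fin.zero → p₀ ; (Fin.suc i) → ps i }

infix 4 _≈[_]_
_≈[_]_ : Pred → ℕ → Pred → Set
S ≈[ H ] T = ∀ m → m ≤ H → S m ⇔ T m

≈-sym : S ≈[ H ] T → T ≈[ H ] S
≈-sym p m m≤H = ⇔-sym (p m m≤H)

≐⇒≈ : S ≐ T → S ≈[ H ] T
≐⇒≈ e m _ = e m

Full : Pred
Full _ = ⊤

∪-agree : S ≈[ H ] D → T ≈[ H ] E → S ∪ T ≈[ H ] D ∪ E
∪-agree p q m m≤H = p m m≤H ⊎-⇔ q m m≤H

∩-agree : S ≈[ H ] D → T ≈[ H ] E → S ∩ T ≈[ H ] D ∩ E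
∩-agree p q m m≤H = p m m≤H ×-⇔ q m m≤H

∁-agree : S ≈[ H ] D → ∁ S ≈[ H ] ∁ D
∁-agree p m m≤H = ¬-cong-⇔ (p m m≤H)

-- Both summands of k are at most k, so ⊕ preserves agreement.
⊕-transfer : S ≈[ H ] D → T ≈[ H ] E → k ≤ H → (S ⊕ T) k → (D ⊕ E) k
⊕-transfer p q k≤H (m , n , sm , tn , refl) =
  m , n , to (p m (≤-trans (m≤m+n m n) k≤H)) sm
        , to (q n (≤-trans (m≤n+m n m) k≤H)) tn , refl

⊕-agree : S ≈[ H ] D → T ≈[ H ] E → S ⊕ T ≈[ H ] D ⊕ E
⊕-agree p q k k≤H = mk⇔ (⊕-transfer p q k≤H) (⊕-transfer (≈-sym p) (≈-sym q) k≤H)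

-- Both factors of a positive number are at most it, so ⊗ preserves
-- agreement at positive arguments.
factors-bounded : ∀ m n → m * n ≡ suc k → m ≤ suc k × n ≤ suc k
factors-bounded m n e = ∣⇒≤ (divides n (trans (sym e) (*-comm m n))) , ∣⇒≤ (divides m (sym e))

⊗-transfer⁺ : S ≈[ H ] D → T ≈[ H ] E → suc k ≤ H → (S ⊗ T) (suc k) → (D ⊗ E) (suc k)
⊗-transfer⁺ p q k<H (m , n , sm , tn , e) with factors-bounded m n e
... | m≤k , n≤k = m , n , to (p m (≤-trans m≤k k<H)) sm , to (q n (≤-trans n≤k k<H)) tn , e

⊗-agree⁺ : S ≈[ H ] D → T ≈[ H ] E → suc k ≤ H → (S ⊗ T) (suc k) ⇔ (D ⊗ E) (suc k)
⊗-agree⁺ p q k<H = mk⇔ (⊗-transfer⁺ p q k<H) (⊗-transfer⁺ (≈-sym p) (≈-sym q) k<H)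

-- At 0 the product S ⊗ T is not determined by S and T below H, so the two
-- possible values at 0 give two candidates.
⊗-agree-with-0 : (S ⊗ T) 0 → S ≈[ H ] D → T ≈[ H ] E → S ⊗ T ≈[ H ] (D ⊗ E) ∪ singleton 0
⊗-agree-with-0 z p q zero    _   = mk⇔ (λ _ → inj₂ refl) (λ _ → z)
⊗-agree-with-0 z p q (suc k) k<H = mk⇔ (inj₁ ∘ to (⊗-agree⁺ p q k<H))
  λ { (inj₁ de) → from (⊗-agree⁺ p q k<H) de ; (inj₂ ()) }

⊗-agree-without-0 : ¬ (S ⊗ T) 0 → S ≈[ H ] D → T ≈[ H ] E → S ⊗ T ≈[ H ] (D ⊗ E) ∩ ∁ (singleton 0)
⊗-agree-without-0 z p q zero    _   = mk⇔ (⊥-elim ∘ z) (λ (_ , ≢0) → ⊥-elim (≢0 refl))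
⊗-agree-without-0 z p q (suc k) k<H = mk⇔ (λ st → to (⊗-agree⁺ p q k<H) st , λ ())
  λ (de , _) → from (⊗-agree⁺ p q k<H) de

Unbounded : ℕ → Pred → Set
Unbounded H S = ∃ λ m → H < m × S m

⇓-agree-unbounded : Unbounded H S → ⇓ S ≈[ H ] Full
⇓-agree-unbounded (m , H<m , sm) k k≤H = mk⇔ (const tt) (const (m , sm , ≤-trans k≤H (<⇒≤ H<m)))

⇓-agree-bounded : ¬ Unbounded H S → S ≈[ H ] D → ⇓ S ≈[ H ] ⇓ (D ∩ (_≤ H))
⇓-agree-bounded {H} {S} {D} bounded p k _ = mk⇔ down up
  where
  down : ⇓ S k → ⇓ (D ∩ (_≤ H)) k
  down (m , sm , k≤m) with m ≤? H
  ... | yes m≤H = m , (to (p m m≤H) sm , m≤H) , k≤m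
  ... | no  m≰H = ⊥-elim (bounded (m , ≰⇒> m≰H , sm))
  up : ⇓ (D ∩ (_≤ H)) k → ⇓ S k
  up (m , (dm , m≤H) , k≤m) = m , from (p m m≤H) dm , k≤m

-- Candidates: sets indexed by the threshold H.
Candidate : Set₁
Candidate = ℕ → Pred

lift₂ : (Pred → Pred → Pred) → Candidate → Candidate → Candidate
lift₂ f D E H = f (D H) (E H)

-- One candidate per way the gates ⊗, ⇓ and 𝒫 can resolve their classical
-- case split; inputs contribute ∅.
candidates : ∀ {k} → Circuit k → List Candidate
candidates (var _)      = [ const ∅ ]
candidates cEmpty       = [ const ∅ ]
candidates cFull        = [ const Full ]
candidates (cSing m)    = [ const (singleton m) ]
candidates (cUnion c d) = cartesianProductWith (lift₂ _∪_) (candidates c) (candidates d)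
candidates (cInter c d) = cartesianProductWith (lift₂ _∩_) (candidates c) (candidates d)
candidates (cCompl c)   = map (λ D H → ∁ (D H)) (candidates c)
candidates (cPlus c d)  = cartesianProductWith (lift₂ _⊕_) (candidates c) (candidates d)
candidates (cTimes c d) =
  cartesianProductWith (lift₂ λ D E → (D ⊗ E) ∪ singleton 0) (candidates c) (candidates d) ++
  cartesianProductWith (lift₂ λ D E → (D ⊗ E) ∩ ∁ (singleton 0)) (candidates c) (candidates d)
candidates (cDown c)    = const Full ∷ map (λ D H → ⇓ (D H ∩ (_≤ H))) (candidates c)
candidates (cP _ _ _)   = const ∅ ∷ const (singleton 0) ∷ []

Matches : ∀ {k} → ℕ → Circuit k → Pred → Set₁
Matches H c S = Any (λ D → S ≈[ H ] D H) (candidates c)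

matches-candidate : ∀ {k} H (ρ : Fin k → Pred) → (∀ i → ρ i ≈[ H ] ∅) →
                    (c : Circuit k) → ¬ ¬ Matches H c (eval c ρ)
matches-candidate H ρ small = go
  where
  go : ∀ c → ¬ ¬ Matches H c (eval c ρ)
  go (var i)      = return (here (small i))
  go cEmpty       = return (here (λ _ _ → ⇔-id _))
  go cFull        = return (here (λ _ _ → ⇔-id _))
  go (cSing m)    = return (here (λ _ _ → ⇔-id _))
  go (cUnion c d) = do
    p ← go c
    q ← go d
    return (cartesianProductWith⁺ (lift₂ _∪_) ∪-agree p q)
  go (cInter c d) = do
    p ← go c
    q ← go d
    return (cartesianProductWith⁺ (lift₂ _∩_) ∩-agree p q)
  go (cCompl c)   = do
    p ← go c
    return (map⁺ (Any.map ∁-agree p))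
  go (cPlus c d)  = do
    p ← go c
    q ← go d
    return (cartesianProductWith⁺ (lift₂ _⊕_) ⊕-agree p q)
  go (cTimes c d) = do
    p ← go c
    q ← go d
    no z ← ¬¬-excluded-middle {A = (eval c ρ ⊗ eval d ρ) 0}
      where yes z → return (++⁺ˡ (cartesianProductWith⁺ _ (⊗-agree-with-0 z) p q))
    return (++⁺ʳ _ (cartesianProductWith⁺ _ (⊗-agree-without-0 z) p q))
  go (cDown c)    = do
    p ← go c
    no bounded ← ¬¬-excluded-middle {A = Unbounded H (eval c ρ)}
      where yes unbounded → return (here (⇓-agree-unbounded unbounded))
    return (there (map⁺ (Any.map (⇓-agree-bounded bounded) p)))
  go (cP _ f cs)  with PFun.values f (λ i → eval (cs i) ρ)
  ... | inj₁ empty = return (here (≐⇒≈ empty))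
  ... | inj₂ zero-only = return (there (here (≐⇒≈ zero-only)))

card-listed : Unique l → Card (_∈ l) (length l)
card-listed {l} u = inj₁ (l , u , (λ _ → ⇔-id _) , refl)

card-listed-unique : Unique l → Card (_∈ l) n → n ≡ length l
card-listed-unique {l} _ (inj₂ infinite) = ⊥-elim (infinite (l , λ _ → ⇔-id _))
card-listed-unique u (inj₁ (l′ , u′ , same , refl)) =
  ↭-length (∼bag⇒↭ (unique∧set⇒bag u′ u λ {m} → ⇔-sym (same m)))

block : ℕ → ℕ → List ℕ
block H n = map (suc H +_) (upTo n)

block-length : length (block H n) ≡ n
block-length {H} {n} = trans (length-map (suc H +_) (upTo n)) (length-upTo n)

block-unique : Unique (block H n)
block-unique {H} {n} = Unique.map⁺ (+-cancelˡ-≡ (suc H) _ _) (Unique.upTo⁺ n)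

block-small : (_∈ block H n) ≈[ H ] ∅
block-small {H} {n} m m≤H = mk⇔ above-H λ ()
  where
  above-H : m ∈ block H n → ⊥
  above-H m∈ with i , _ , refl ← ∈-map⁻ (suc H +_) m∈ = <-irrefl refl (≤-trans (m≤m+n (suc H) i) m≤H)

card-block : Card (_∈ block H n) n
card-block {H} {n} = subst (Card (_∈ block H n)) block-length (card-listed block-unique)

card-block-unique : Card (_∈ block H n′) n → n ≡ n′
card-block-unique c = trans (card-listed-unique block-unique c) block-length

blocks-separated : ∀ (c : Circuit 1) → (∀ ρ → eval c ρ ≐ CardFun ρ) → n ≤ H →
                   eval c (const (_∈ block H n)) ≈[ H ] D →
                   eval c (const (_∈ block H n′)) ≈[ H ] D → n ≡ n′
blocks-separated c computes n≤H p p′ = card-block-unique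
  (to (computes _ _) (from (p′ _ n≤H) (to (p _ n≤H) (from (computes _ _) card-block))))

theorem13 : ¬ Definable CardFun
theorem13 (c , computes) = ¬¬-Π-Fin (suc L) matches collision
  where
  L : ℕ
  L = length (candidates c)
  input : Fin (suc L) → Fin 1 → Pred
  input i = const (_∈ block L (toℕ i))
  matches : ∀ i → ¬ ¬ Matches L c (eval c (input i))
  matches i = matches-candidate L (input i) (const block-small) c
  collision : ¬ (∀ i → Matches L c (eval c (input i)))
  collision match with i , j , i<j , same ← pigeonhole (n<1+n L) (index ∘ match) =
    <-irrefl (blocks-separated c computes (toℕ≤pred[n] i) (lookup-index (match i)) agree-j) i<j
    where
    agree-j : eval c (input j) ≈[ L ] lookup (candidates c) (index (match i)) L
    agree-j rewrite same = lookup-index (match j)
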